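{- Let $A$ be an $n\times n$ real skew-symmetric matrix ($A_{ji}=-A_{ij}$ for all $i,j$) with ppr-sequence $r_0r_1\cdots r_n$. Then $r_{2i+1}=0$ for all integers $i$ with $0\le i\le\lfloor\frac{n-1}{2}\rfloor$.
   Context: The permanent of a $p\times p$ matrix is ${\rm per}(A)=\sum_{\sigma\in S_p}\prod_{i=1}^p a_{i\sigma(i)}$. The ppr-sequence of an $n\times n$ matrix $A$ is $r_0r_1\cdots r_n$ where, for $1\le k\le n$, $r_k=1$ iff $A$ has a principal submatrix of size $k$ with nonzero permanent (else $0$), and $r_0=1$ iff $A$ has a zero entry on its main diagonal. -}

module Defs where

open import Level using (Level)
open import Data.Nat using (ℕ; zero; suc)
open import Data.Fin using (Fin; zero; suc; _<_; _≟_)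
open import Data.Bool using (Bool; true; false; _∧_; _∨_; not)
open import Data.List using (List; []; _∷_; map; concatMap; allFin; filter; foldr)
open import Data.Bool.ListAction using (and)
open import Data.Product using (Σ; _×_; _,_)
open import Relation.Nullary using (¬_)
open import Relation.Nullary.Decidable using (⌊_⌋)
open import Relation.Binary.PropositionalEquality using (_≡_)
open import Algebra.Bundles using (CommutativeRing)

Matrix : ∀ {a} → Set a → ℕ → ℕ → Set a
Matrix X m n = Fin m → Fin n → X

allFuns : (p q : ℕ) → List (Fin p → Fin q)
allFuns zero    q = (λ ()) ∷ []
allFuns (suc p) q =
  concatMap (λ f → map (λ j → λ { zero → j ; (suc i) → f i }) (allFin q)) (allFuns p q)

isInjectiveᵇ : {p : ℕ} → (Fin p → Fin p) → Bool
isInjectiveᵇ {p} σ =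
  and (concatMap (λ i → map (λ j → not ⌊ σ i ≟ σ j ⌋ ∨ ⌊ i ≟ j ⌋) (allFin p)) (allFin p))

Sym : (p : ℕ) → List (Fin p → Fin p)
Sym p = filter (λ σ → isInjectiveᵇ σ Data.Bool.≟ true) (allFuns p p)

module _ {c ℓ} (R : CommutativeRing c ℓ) where
  open CommutativeRing R

  sumL : List Carrier → Carrier
  sumL = foldr _+_ 0#

  prodFin : {p : ℕ} → (Fin p → Carrier) → Carrier
  prodFin {p} f = foldr (λ i acc → f i * acc) 1# (allFin p)

  per : {p : ℕ} → Matrix Carrier p p → Carrier
  per {p} A = sumL (map (λ σ → prodFin (λ i → A i (σ i))) (Sym p))

  SkewSymmetric : {n : ℕ} → Matrix Carrier n n → Set ℓ
  SkewSymmetric A = ∀ i j → A j i ≈ - (A i j)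

  -- strictly increasing index selections Fin k → Fin n (k-subsets of Fin n)
  StrictlyIncreasing : {k n : ℕ} → (Fin k → Fin n) → Set
  StrictlyIncreasing s = ∀ i j → i < j → s i < s j

  principalSub : {k n : ℕ} → Matrix Carrier n n → (Fin k → Fin n) → Matrix Carrier k k
  principalSub A s i j = A (s i) (s j)

  -- r_k = 1 in the ppr-sequence (for 1 ≤ k ≤ n): some principal submatrix
  -- of size k has nonzero permanent.  r_k = 0 is its negation.
  ppr-r≡1 : {n : ℕ} → Matrix Carrier n n → ℕ → Set ℓ
  ppr-r≡1 {n} A k =
    Σ (Fin k → Fin n) (λ s → StrictlyIncreasing s × ¬ (per (principalSub A s) ≈ 0#))

-- The permanent is invariant under transposition (reindex the sum over S_p
-- by σ ↦ σ⁻¹) and per(−B) = (−1)^p per(B).  For a skew-symmetric B of odd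
-- size these give per(B) = per(Bᵀ) = per(−B) = −per(B), so 2·per(B) = 0,
-- and per(B) = 0 as soon as 2 is not a zero divisor.  Every principal
-- submatrix of a skew-symmetric matrix is skew-symmetric.
module Submission where

open import Defs
open import Data.Nat using (ℕ; suc; _*_; _≤_)
open import Relation.Nullary using (¬_)
open import Algebra.Bundles using (CommutativeRing)

open import Algebra.Bundles using (CommutativeMonoid)
open import Data.Bool using (Bool; true; T; not; _∨_)
import Data.Bool as Bool
open import Data.Bool.ListAction using (and)
open import Data.Bool.Properties using (T-≡)
open import Data.Fin using (Fin; zero; suc; _≟_; punchOut)
open import Data.Fin.Permutation using (permutation)
open import Data.Fin.Properties using (any?; all?; punchOut-injective; injective⇒≤; suc-injective)
open import Data.List using (List; []; _∷_; _++_; map; concatMap; filter; foldr; allFin; tabulate)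
open import Data.List.Membership.Propositional.Properties using (∈-allFin)
open import Data.List.Properties using (map-id; map-∘; map-tabulate)
import Data.List.Relation.Unary.All as All
open import Data.List.Relation.Unary.All using (All)
open import Data.List.Relation.Unary.All.Properties using (all⁺; all⁻; concat⁺; concat⁻; map⁺; map⁻)
open import Data.Nat using (zero)
open import Data.Nat.Properties using (1+n≰n; *-suc)
open import Data.Product using (∃; _×_; _,_)
import Data.Product as Product
open import Data.Vec.Functional as Vector using (Vector; head; tail)
open import Function using (_∘_; id; Equivalence)
open import Function.Definitions using (Injective)
open import Level using (Level)
open import Relation.Binary.Core using (_Preserves_⟶_)
import Relation.Binary.PropositionalEquality as ≡
open import Relation.Binary.PropositionalEquality using (_≡_; _≢_; _≗_)
open import Relation.Nullary using (Dec; yes; no)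
open import Relation.Nullary.Decidable using (⌊_⌋; _×-dec_)
open import Relation.Nullary.Negation using (contradiction)
open import Relation.Unary using (Pred; Decidable)

private
  variable
    a b : Level
    A B : Set a
    m n p q : ℕ

T-and⁺ : ∀ bs → T (and bs) → All T bs
T-and⁺ bs h = all⁺ id bs (≡.subst (T ∘ and) (≡.sym (map-id bs)) h)

T-and⁻ : ∀ bs → All T bs → T (and bs)
T-and⁻ bs h = ≡.subst (T ∘ and) (map-id bs) (all⁻ id h)

T-implication⁻ : (A? : Dec A) (B? : Dec B) → T (not ⌊ A? ⌋ ∨ ⌊ B? ⌋) → A → B
T-implication⁻ (yes _) (yes y) _ _ = y
T-implication⁻ (yes _) (no _)  ()
T-implication⁻ (no ¬x) _       _ x = contradiction x ¬x

T-implication⁺ : (A? : Dec A) (B? : Dec B) → (A → B) → T (not ⌊ A? ⌋ ∨ ⌊ B? ⌋)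
T-implication⁺ (yes _) (yes _) _ = _
T-implication⁺ (yes x) (no ¬y) f = contradiction (f x) ¬y
T-implication⁺ (no _)  _       _ = _

distinctᵇ : (Fin p → Fin p) → Fin p → Fin p → Bool
distinctᵇ σ i j = not ⌊ σ i ≟ σ j ⌋ ∨ ⌊ i ≟ j ⌋

isInjectiveᵇ-sound : (σ : Fin p → Fin p) → isInjectiveᵇ σ ≡ true → Injective _≡_ _≡_ σ
isInjectiveᵇ-sound {p} σ h {i} {j} = T-implication⁻ (σ i ≟ σ j) (i ≟ j) (All.lookup (row i) (∈-allFin j))
  where
  rows : All (λ i → All T (map (distinctᵇ σ i) (allFin p))) (allFin p)
  rows = map⁻ (concat⁻ (T-and⁺ _ (Equivalence.from T-≡ h)))
  row : ∀ i → All (T ∘ distinctᵇ σ i) (allFin p)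
  row i = map⁻ (All.lookup rows (∈-allFin i))

isInjectiveᵇ-complete : (σ : Fin p → Fin p) → Injective _≡_ _≡_ σ → isInjectiveᵇ σ ≡ true
isInjectiveᵇ-complete {p} σ inj = Equivalence.to T-≡ (T-and⁻ _ (concat⁺ (map⁺ (All.universal row (allFin p)))))
  where
  row : ∀ i → All T (map (distinctᵇ σ i) (allFin p))
  row i = map⁺ (All.universal (λ j → T-implication⁺ (σ i ≟ σ j) (i ≟ j) inj) (allFin p))

injective⇒surjective : {σ : Fin n → Fin n} → Injective _≡_ _≡_ σ → ∀ j → ∃ λ i → σ i ≡ j
injective⇒surjective {suc n} {σ} inj j with any? (λ i → σ i ≟ j)
... | yes hit = hit
... | no miss = contradiction (injective⇒≤ punchOut-inj) 1+n≰n
  where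
  j≢σ : ∀ i → j ≢ σ i
  j≢σ i j≡σi = miss (i , ≡.sym j≡σi)
  punchOut-inj : Injective _≡_ _≡_ (λ i → punchOut (j≢σ i))
  punchOut-inj eq = inj (punchOut-injective (j≢σ _) (j≢σ _) eq)

-- The junk value j on points outside the image makes inverse total; it is
-- a two-sided inverse whenever σ is injective.
inverse : (Fin n → Fin n) → Fin n → Fin n
inverse σ j with any? (λ i → σ i ≟ j)
... | yes (i , _) = i
... | no _        = j

∘-inverse : {σ : Fin n → Fin n} → Injective _≡_ _≡_ σ → ∀ j → σ (inverse σ j) ≡ j
∘-inverse {σ = σ} inj j with any? (λ i → σ i ≟ j)
... | yes (_ , σi≡j) = σi≡j
... | no miss        = contradiction (injective⇒surjective inj j) miss

inverse-∘ : {σ : Fin n → Fin n} → Injective _≡_ _≡_ σ → ∀ i → inverse σ (σ i) ≡ i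
inverse-∘ {σ = σ} inj i = inj (∘-inverse inj (σ i))

inverse-swap : {σ τ : Fin n → Fin n} → Injective _≡_ _≡_ σ → τ ≗ inverse σ →
               Injective _≡_ _≡_ τ × σ ≗ inverse τ
inverse-swap {σ = σ} {τ} σ-inj τ≗σ⁻¹ = τ-inj , σ≗τ⁻¹
  where
  open ≡.≡-Reasoning
  τ-inj : Injective _≡_ _≡_ τ
  τ-inj {x} {y} τx≡τy = begin
    x                   ≡⟨ ∘-inverse σ-inj x ⟨
    σ (inverse σ x)     ≡⟨ ≡.cong σ (≡.trans (≡.sym (τ≗σ⁻¹ x)) (≡.trans τx≡τy (τ≗σ⁻¹ y))) ⟩
    σ (inverse σ y)     ≡⟨ ∘-inverse σ-inj y ⟩
    y                   ∎
  σ≗τ⁻¹ : σ ≗ inverse τ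
  σ≗τ⁻¹ i = begin
    σ i                 ≡⟨ inverse-∘ τ-inj (σ i) ⟨
    inverse τ (τ (σ i)) ≡⟨ ≡.cong (inverse τ) (≡.trans (τ≗σ⁻¹ (σ i)) (inverse-∘ σ-inj i)) ⟩
    inverse τ i         ∎

_≗?_ : (f g : Fin p → Fin q) → Dec (f ≗ g)
f ≗? g = all? (λ i → f i ≟ g i)

module ListSum {c ℓ} (M : CommutativeMonoid c ℓ) where
  open CommutativeMonoid M
    renaming (_∙_ to _+_; ε to 0#; ∙-cong to +-cong; ∙-congˡ to +-congˡ;
              identityˡ to +-identityˡ; identityʳ to +-identityʳ; assoc to +-assoc)
  open import Algebra.Properties.CommutativeSemigroup commutativeSemigroup using (interchange)
  open import Relation.Binary.Reasoning.Setoid setoid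

  ∑ : List A → (A → Carrier) → Carrier
  ∑ xs f = foldr _+_ 0# (map f xs)

  syntax ∑ xs (λ x → e) = ∑[ x ∈ xs ] e

  ∑-cong : ∀ xs {f g : A → Carrier} → (∀ x → f x ≈ g x) → ∑ xs f ≈ ∑ xs g
  ∑-cong []       _   = refl
  ∑-cong (x ∷ xs) f≈g = +-cong (f≈g x) (∑-cong xs f≈g)

  ∑-map : ∀ xs (g : A → B) (f : B → Carrier) → ∑ (map g xs) f ≡ ∑ xs (f ∘ g)
  ∑-map xs g f = ≡.cong (foldr _+_ 0#) (≡.sym (map-∘ xs))

  ∑-0# : ∀ (xs : List A) → ∑[ x ∈ xs ] 0# ≈ 0#
  ∑-0# []       = refl
  ∑-0# (x ∷ xs) = trans (+-identityˡ _) (∑-0# xs)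

  ∑-++ : ∀ xs ys (f : A → Carrier) → ∑ (xs ++ ys) f ≈ ∑ xs f + ∑ ys f
  ∑-++ []       ys f = sym (+-identityˡ _)
  ∑-++ (x ∷ xs) ys f = trans (+-congˡ (∑-++ xs ys f)) (sym (+-assoc _ _ _))

  ∑-concatMap : ∀ xs (k : A → List B) (f : B → Carrier) →
                ∑ (concatMap k xs) f ≈ ∑[ x ∈ xs ] ∑ (k x) f
  ∑-concatMap []       k f = refl
  ∑-concatMap (x ∷ xs) k f = trans (∑-++ (k x) _ f) (+-congˡ (∑-concatMap xs k f))

  ∑-distrib-+ : ∀ xs (f g : A → Carrier) → ∑[ x ∈ xs ] (f x + g x) ≈ ∑ xs f + ∑ xs g
  ∑-distrib-+ []       f g = sym (+-identityˡ 0#)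
  ∑-distrib-+ (x ∷ xs) f g = trans (+-congˡ (∑-distrib-+ xs f g)) (interchange _ _ _ _)

  ∑-comm : ∀ xs ys (h : A → B → Carrier) → ∑[ x ∈ xs ] ∑[ y ∈ ys ] h x y ≈ ∑[ y ∈ ys ] ∑[ x ∈ xs ] h x y
  ∑-comm []       ys h = sym (∑-0# ys)
  ∑-comm (x ∷ xs) ys h = trans (+-congˡ (∑-comm xs ys h)) (sym (∑-distrib-+ ys _ _))

  ∑-allFin-suc : ∀ (f : Fin (suc n) → Carrier) → ∑ (allFin (suc n)) f ≡ f zero + ∑ (allFin n) (f ∘ suc)
  ∑-allFin-suc f = ≡.cong (λ xs → f zero + foldr _+_ 0# xs)
    (≡.trans (map-tabulate suc f) (≡.sym (map-tabulate id (f ∘ suc))))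

  when : {P : Set a} → Dec P → Carrier → Carrier
  when (yes _) x = x
  when (no _)  _ = 0#

  when-cong : {P : Set a} (P? : Dec P) {x y : Carrier} → (P → x ≈ y) → when P? x ≈ when P? y
  when-cong (yes p) x≈y = x≈y p
  when-cong (no _)  _   = refl

  when-yes : {P : Set a} {P? : Dec P} {x : Carrier} → P → when P? x ≈ x
  when-yes {P? = yes _} _ = refl
  when-yes {P? = no ¬p} p = contradiction p ¬p

  when-⇔ : {P : Set a} {Q : Set b} (P? : Dec P) (Q? : Dec Q) {x : Carrier} →
           (P → Q) → (Q → P) → when P? x ≈ when Q? x
  when-⇔ (yes _) (yes _) _ _ = refl
  when-⇔ (yes p) (no ¬q) f _ = contradiction (f p) ¬q
  when-⇔ (no ¬p) (yes q) _ g = contradiction (g q) ¬p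
  when-⇔ (no _)  (no _)  _ _ = refl

  when-× : {P : Set a} {Q : Set b} (P? : Dec P) (Q? : Dec Q) {x : Carrier} →
           when P? (when Q? x) ≈ when (P? ×-dec Q?) x
  when-× (yes _) (yes _) = refl
  when-× (yes _) (no _)  = refl
  when-× (no _)  _       = refl

  when-∑ : {P : Set a} (P? : Dec P) (xs : List A) (f : A → Carrier) →
           when P? (∑ xs f) ≈ ∑[ x ∈ xs ] when P? (f x)
  when-∑ (yes _) xs f = refl
  when-∑ (no _)  xs f = sym (∑-0# xs)

  ∑-filter : {P : Pred A b} (P? : Decidable P) (xs : List A) (f : A → Carrier) →
             ∑ (filter P? xs) f ≈ ∑[ x ∈ xs ] when (P? x) (f x)
  ∑-filter P? []       f = refl
  ∑-filter P? (x ∷ xs) f with P? x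
  ... | yes _ = +-congˡ (∑-filter P? xs f)
  ... | no _  = trans (∑-filter P? xs f) (sym (+-identityˡ _))

  ∑-allFin-δ : ∀ (j₀ : Fin n) (f : Fin n → Carrier) → ∑[ j ∈ allFin n ] when (j ≟ j₀) (f j) ≈ f j₀
  ∑-allFin-δ {suc n} zero f = begin
    ∑[ j ∈ allFin (suc n) ] when (j ≟ zero) (f j) ≡⟨ ∑-allFin-suc (λ j → when (j ≟ zero) (f j)) ⟩
    f zero + ∑[ j ∈ allFin n ] 0#                  ≈⟨ +-congˡ (∑-0# (allFin n)) ⟩
    f zero + 0#                                    ≈⟨ +-identityʳ _ ⟩
    f zero                                         ∎
  ∑-allFin-δ {suc n} (suc j₀) f = begin
    ∑[ j ∈ allFin (suc n) ] when (j ≟ suc j₀) (f j)    ≡⟨ ∑-allFin-suc (λ j → when (j ≟ suc j₀) (f j)) ⟩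
    0# + ∑[ j ∈ allFin n ] when (suc j ≟ suc j₀) (f (suc j))
      ≈⟨ +-identityˡ _ ⟩
    ∑[ j ∈ allFin n ] when (suc j ≟ suc j₀) (f (suc j))
      ≈⟨ ∑-cong (allFin n) (λ j → when-⇔ (suc j ≟ suc j₀) (j ≟ j₀) suc-injective (≡.cong suc)) ⟩
    ∑[ j ∈ allFin n ] when (j ≟ j₀) (f (suc j))        ≈⟨ ∑-allFin-δ j₀ (f ∘ suc) ⟩
    f (suc j₀)                                          ∎

  ∑-allFuns-suc : ∀ (F : (Fin (suc p) → Fin q) → Carrier) → F Preserves _≗_ ⟶ _≈_ →
                  ∑ (allFuns (suc p) q) F ≈ ∑[ f ∈ allFuns p q ] ∑[ j ∈ allFin q ] F (j Vector.∷ f)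
  ∑-allFuns-suc {p} {q} F F-cong = trans (∑-concatMap (allFuns p q) _ F) (∑-cong (allFuns p q) (λ f →
    trans (reflexive (∑-map (allFin q) _ F))
          (∑-cong (allFin q) (λ j → F-cong (λ { zero → ≡.refl ; (suc i) → ≡.refl })))))

  -- Sifting property of the Kronecker delta: allFuns p q lists every
  -- function exactly once up to pointwise equality.
  ∑-allFuns-δ : ∀ (f₀ : Fin p → Fin q) (t : (Fin p → Fin q) → Carrier) → t Preserves _≗_ ⟶ _≈_ →
                ∑[ f ∈ allFuns p q ] when (f ≗? f₀) (t f) ≈ t f₀
  ∑-allFuns-δ {zero} f₀ t t-cong = only-function
    where
    only-function : ∀ {g} → when (g ≗? f₀) (t g) + 0# ≈ t f₀
    only-function {g} = trans (+-identityʳ _) (trans (when-yes {P? = g ≗? f₀} (λ ())) (t-cong (λ ())))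
  ∑-allFuns-δ {suc p} {q} f₀ t t-cong = begin
    ∑[ g ∈ allFuns (suc p) q ] when (g ≗? f₀) (t g)
      ≈⟨ ∑-allFuns-suc _ summand-cong ⟩
    ∑[ f ∈ allFuns p q ] ∑[ j ∈ allFin q ] when ((j Vector.∷ f) ≗? f₀) (t (j Vector.∷ f))
      ≈⟨ ∑-cong (allFuns p q) (λ f → ∑-cong (allFin q) (λ j →
           trans (when-⇔ ((j Vector.∷ f) ≗? f₀) (j ≟ head f₀ ×-dec f ≗? tail f₀) split join)
                 (sym (when-× (j ≟ head f₀) (f ≗? tail f₀))))) ⟩
    ∑[ f ∈ allFuns p q ] ∑[ j ∈ allFin q ] when (j ≟ head f₀) (when (f ≗? tail f₀) (t (j Vector.∷ f)))
      ≈⟨ ∑-cong (allFuns p q) (λ f → ∑-allFin-δ (head f₀) _) ⟩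
    ∑[ f ∈ allFuns p q ] when (f ≗? tail f₀) (t (head f₀ Vector.∷ f))
      ≈⟨ ∑-allFuns-δ (tail f₀) _ (λ f≗g → t-cong (λ { zero → ≡.refl ; (suc i) → f≗g i })) ⟩
    t (head f₀ Vector.∷ tail f₀)
      ≈⟨ t-cong (λ { zero → ≡.refl ; (suc i) → ≡.refl }) ⟩
    t f₀ ∎
    where
    summand-cong : (λ g → when (g ≗? f₀) (t g)) Preserves _≗_ ⟶ _≈_
    summand-cong {g} {h} g≗h = trans
      (when-⇔ (g ≗? f₀) (h ≗? f₀) (λ e i → ≡.trans (≡.sym (g≗h i)) (e i)) (λ e i → ≡.trans (g≗h i) (e i)))
      (when-cong (h ≗? f₀) (λ _ → t-cong g≗h))
    split : ∀ {j f} → (j Vector.∷ f) ≗ f₀ → j ≡ head f₀ × f ≗ tail f₀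
    split e = e zero , e ∘ suc
    join : ∀ {j f} → j ≡ head f₀ × f ≗ tail f₀ → (j Vector.∷ f) ≗ f₀
    join (e₀ , _) zero    = e₀
    join (_  , e) (suc i) = e i

  -- The hypothesis says that "P σ and τ ≗ φ σ" is a symmetric relation,
  -- i.e. φ is an involution of P up to pointwise equality.
  ∑-allFuns-reindex : {P : Pred (Fin p → Fin q) b} (P? : Decidable P) (φ : (Fin p → Fin q) → Fin p → Fin q) →
                      (∀ {σ τ} → P σ → τ ≗ φ σ → P τ × σ ≗ φ τ) →
                      (t : (Fin p → Fin q) → Carrier) → t Preserves _≗_ ⟶ _≈_ →
                      ∑[ σ ∈ allFuns p q ] when (P? σ) (t (φ σ)) ≈ ∑[ σ ∈ allFuns p q ] when (P? σ) (t σ)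
  ∑-allFuns-reindex {p} {q} P? φ swap t t-cong = begin
    ∑[ σ ∈ Fs ] when (P? σ) (t (φ σ))
      ≈⟨ ∑-cong Fs (λ σ → when-cong (P? σ) (λ _ → sym (∑-allFuns-δ (φ σ) t t-cong))) ⟩
    ∑[ σ ∈ Fs ] when (P? σ) (∑[ τ ∈ Fs ] when (τ ≗? φ σ) (t τ))
      ≈⟨ ∑-cong Fs (λ σ → when-∑ (P? σ) Fs _) ⟩
    ∑[ σ ∈ Fs ] ∑[ τ ∈ Fs ] when (P? σ) (when (τ ≗? φ σ) (t τ))
      ≈⟨ ∑-comm Fs Fs _ ⟩
    ∑[ τ ∈ Fs ] ∑[ σ ∈ Fs ] when (P? σ) (when (τ ≗? φ σ) (t τ))
      ≈⟨ ∑-cong Fs (λ τ → ∑-cong Fs (λ σ → swap-when σ τ)) ⟩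
    ∑[ τ ∈ Fs ] ∑[ σ ∈ Fs ] when (P? τ) (when (σ ≗? φ τ) (t τ))
      ≈⟨ ∑-cong Fs (λ τ → sym (when-∑ (P? τ) Fs _)) ⟩
    ∑[ τ ∈ Fs ] when (P? τ) (∑[ σ ∈ Fs ] when (σ ≗? φ τ) (t τ))
      ≈⟨ ∑-cong Fs (λ τ → when-cong (P? τ) (λ _ → ∑-allFuns-δ (φ τ) (λ _ → t τ) (λ _ → refl))) ⟩
    ∑[ τ ∈ Fs ] when (P? τ) (t τ) ∎
    where
    Fs : List (Fin p → Fin q)
    Fs = allFuns p q
    swap-when : ∀ σ τ → when (P? σ) (when (τ ≗? φ σ) (t τ)) ≈ when (P? τ) (when (σ ≗? φ τ) (t τ))
    swap-when σ τ = begin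
      when (P? σ) (when (τ ≗? φ σ) (t τ))  ≈⟨ when-× (P? σ) (τ ≗? φ σ) ⟩
      when (P? σ ×-dec τ ≗? φ σ) (t τ)
        ≈⟨ when-⇔ (P? σ ×-dec τ ≗? φ σ) (P? τ ×-dec σ ≗? φ τ) (Product.uncurry swap) (Product.uncurry swap) ⟩
      when (P? τ ×-dec σ ≗? φ τ) (t τ)     ≈⟨ when-× (P? τ) (σ ≗? φ τ) ⟨
      when (P? τ) (when (σ ≗? φ τ) (t τ))  ∎

injective? : Decidable (λ (σ : Fin p → Fin p) → isInjectiveᵇ σ ≡ true)
injective? σ = isInjectiveᵇ σ Bool.≟ true

module _ {c ℓ} (R : CommutativeRing c ℓ) where
  open CommutativeRing R hiding (zero) renaming (_*_ to _·_)
  open ListSum +-commutativeMonoid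
  open import Algebra.Properties.CommutativeSemigroup *-commutativeSemigroup using (x∙yz≈y∙xz)
  open import Algebra.Properties.Ring ring using (-‿distribˡ-*; -‿involutive; -1*x≈-x)
  open import Algebra.Properties.CommutativeMonoid.Sum *-commutativeMonoid
    using (sum-cong-≋; sum-permute) renaming (sum to ∏)
  open import Relation.Binary.Reasoning.Setoid setoid

  *-distribˡ-∑ : ∀ x (ys : List A) (f : A → Carrier) → x · ∑ ys f ≈ ∑[ y ∈ ys ] (x · f y)
  *-distribˡ-∑ x []       f = zeroʳ x
  *-distribˡ-∑ x (y ∷ ys) f = trans (distribˡ x _ _) (+-congˡ (*-distribˡ-∑ x ys f))

  sign : ℕ → Carrier
  sign zero    = 1#
  sign (suc n) = - sign n

  sign-odd : ∀ i → sign (suc (2 * i)) ≈ - 1#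
  sign-odd zero    = refl
  sign-odd (suc i) = begin
    sign (suc (2 * suc i)) ≡⟨ ≡.cong (sign ∘ suc) (*-suc 2 i) ⟩
    - - sign (suc (2 * i)) ≈⟨ -‿involutive _ ⟩
    sign (suc (2 * i))     ≈⟨ sign-odd i ⟩
    - 1#                   ∎

  foldr-tabulate : ∀ (f : Fin m → Carrier) (g : Fin n → Fin m) →
                   foldr (λ i acc → f i · acc) 1# (tabulate g) ≡ ∏ (f ∘ g)
  foldr-tabulate {n = zero}  f g = ≡.refl
  foldr-tabulate {n = suc n} f g = ≡.cong (f (g zero) ·_) (foldr-tabulate f (g ∘ suc))

  prodFin≡∏ : ∀ (f : Fin n → Carrier) → prodFin R f ≡ ∏ f
  prodFin≡∏ f = foldr-tabulate f id

  prodFin-cong : {f g : Fin n → Carrier} → (∀ i → f i ≈ g i) → prodFin R f ≈ prodFin R g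
  prodFin-cong {f = f} {g} f≈g = begin
    prodFin R f ≡⟨ prodFin≡∏ f ⟩
    ∏ f         ≈⟨ sum-cong-≋ f≈g ⟩
    ∏ g         ≡⟨ prodFin≡∏ g ⟨
    prodFin R g ∎

  prodFin-permute : {σ : Fin n → Fin n} → Injective _≡_ _≡_ σ → (f : Fin n → Carrier) →
                    prodFin R (f ∘ σ) ≈ prodFin R f
  prodFin-permute {σ = σ} inj f = begin
    prodFin R (f ∘ σ) ≡⟨ prodFin≡∏ (f ∘ σ) ⟩
    ∏ (f ∘ σ)         ≈⟨ sum-permute f (permutation σ (inverse σ) (∘-inverse inj) (inverse-∘ inj)) ⟨
    ∏ f               ≡⟨ prodFin≡∏ f ⟨
    prodFin R f       ∎

  ∏-neg : ∀ (f : Vector Carrier n) → ∏ (λ i → - f i) ≈ sign n · ∏ f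
  ∏-neg {zero}  f = sym (*-identityˡ 1#)
  ∏-neg {suc n} f = begin
    - head f · ∏ (λ i → - tail f i)    ≈⟨ *-congˡ (∏-neg (tail f)) ⟩
    - head f · (sign n · ∏ (tail f))   ≈⟨ -‿distribˡ-* _ _ ⟨
    - (head f · (sign n · ∏ (tail f))) ≈⟨ -‿cong (x∙yz≈y∙xz _ _ _) ⟩
    - (sign n · (head f · ∏ (tail f))) ≈⟨ -‿distribˡ-* _ _ ⟩
    - sign n · (head f · ∏ (tail f))   ∎

  prodFin-neg : ∀ (f : Fin n → Carrier) → prodFin R (λ i → - f i) ≈ sign n · prodFin R f
  prodFin-neg {n} f = begin
    prodFin R (λ i → - f i) ≡⟨ prodFin≡∏ (λ i → - f i) ⟩
    ∏ (λ i → - f i)         ≈⟨ ∏-neg f ⟩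
    sign n · ∏ f            ≡⟨ ≡.cong (sign n ·_) (prodFin≡∏ f) ⟨
    sign n · prodFin R f    ∎

  perTerm : Matrix Carrier n n → (Fin n → Fin n) → Carrier
  perTerm B σ = prodFin R (λ i → B i (σ i))

  perTerm-cong : ∀ (B : Matrix Carrier n n) → perTerm B Preserves _≗_ ⟶ _≈_
  perTerm-cong B σ≗τ = prodFin-cong (λ i → reflexive (≡.cong (B i) (σ≗τ i)))

  perTerm-transpose : ∀ (B : Matrix Carrier n n) {σ : Fin n → Fin n} → Injective _≡_ _≡_ σ →
                      perTerm (λ i j → B j i) σ ≈ perTerm B (inverse σ)
  perTerm-transpose B {σ} inj = begin
    prodFin R (λ i → B (σ i) i)
      ≈⟨ prodFin-cong (λ i → reflexive (≡.cong (B (σ i)) (inverse-∘ inj i))) ⟨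
    prodFin R (λ i → B (σ i) (inverse σ (σ i)))
      ≈⟨ prodFin-permute inj (λ i → B i (inverse σ i)) ⟩
    prodFin R (λ i → B i (inverse σ i)) ∎

  per-cong : {B C : Matrix Carrier n n} → (∀ i j → B i j ≈ C i j) → per R B ≈ per R C
  per-cong {n} B≈C = ∑-cong (Sym n) (λ σ → prodFin-cong (λ i → B≈C i (σ i)))

  per-neg : ∀ (B : Matrix Carrier n n) → per R (λ i j → - B i j) ≈ sign n · per R B
  per-neg {n} B = begin
    ∑[ σ ∈ Sym n ] prodFin R (λ i → - B i (σ i)) ≈⟨ ∑-cong (Sym n) (λ σ → prodFin-neg (λ i → B i (σ i))) ⟩
    ∑[ σ ∈ Sym n ] (sign n · perTerm B σ)       ≈⟨ *-distribˡ-∑ (sign n) (Sym n) (perTerm B) ⟨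
    sign n · per R B                             ∎

  per-transpose : ∀ (B : Matrix Carrier n n) → per R (λ i j → B j i) ≈ per R B
  per-transpose {n} B = begin
    per R (λ i j → B j i)
      ≈⟨ ∑-filter injective? (allFuns n n) _ ⟩
    ∑[ σ ∈ allFuns n n ] when (injective? σ) (perTerm (λ i j → B j i) σ)
      ≈⟨ ∑-cong (allFuns n n) (λ σ → when-cong (injective? σ)
           (λ σ-inj → perTerm-transpose B (isInjectiveᵇ-sound σ σ-inj))) ⟩
    ∑[ σ ∈ allFuns n n ] when (injective? σ) (perTerm B (inverse σ))
      ≈⟨ ∑-allFuns-reindex injective? inverse swap (perTerm B) (perTerm-cong B) ⟩
    ∑[ σ ∈ allFuns n n ] when (injective? σ) (perTerm B σ)
      ≈⟨ ∑-filter injective? (allFuns n n) _ ⟨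
    per R B ∎
    where
    swap : ∀ {σ τ} → isInjectiveᵇ σ ≡ true → τ ≗ inverse σ → isInjectiveᵇ τ ≡ true × σ ≗ inverse τ
    swap {σ} {τ} σ-inj τ≗σ⁻¹ =
      Product.map₁ (isInjectiveᵇ-complete τ) (inverse-swap (isInjectiveᵇ-sound σ σ-inj) τ≗σ⁻¹)

  per-skew : ∀ {B : Matrix Carrier n n} → SkewSymmetric R B → per R B ≈ sign n · per R B
  per-skew {n} {B} skew = begin
    per R B                   ≈⟨ per-transpose B ⟨
    per R (λ i j → B j i)     ≈⟨ per-cong skew ⟩
    per R (λ i j → - B i j)   ≈⟨ per-neg B ⟩
    sign n · per R B          ∎

  per-skew-odd≈0# : (∀ x → x + x ≈ 0# → x ≈ 0#) → ∀ i {B : Matrix Carrier (suc (2 * i)) (suc (2 * i))} →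
                 SkewSymmetric R B → per R B ≈ 0#
  per-skew-odd≈0# 2-regular i {B} skew = 2-regular (per R B) (begin
    per R B + per R B                      ≈⟨ +-congˡ (per-skew skew) ⟩
    per R B + sign (suc (2 * i)) · per R B ≈⟨ +-congˡ (*-congʳ (sign-odd i)) ⟩
    per R B + - 1# · per R B               ≈⟨ +-congˡ (-1*x≈-x _) ⟩
    per R B + - per R B                    ≈⟨ -‿inverseʳ _ ⟩
    0#                                     ∎)

-- The size bound and the monotonicity of the index selection are not needed.
lemma5p1 : ∀ {c ℓ} (R : CommutativeRing c ℓ)
           → (∀ x → CommutativeRing._≈_ R (CommutativeRing._+_ R x x) (CommutativeRing.0# R)
                  → CommutativeRing._≈_ R x (CommutativeRing.0# R))
           → (n : ℕ) (A : Matrix (CommutativeRing.Carrier R) n n)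
           → SkewSymmetric R A
           → ∀ (i : ℕ) → suc (2 * i) ≤ n → ¬ ppr-r≡1 R A (suc (2 * i))
lemma5p1 R 2-regular n A skew i _ (s , _ , per≉0) =
  per≉0 (per-skew-odd≈0# R 2-regular i (λ j k → skew (s j) (s k)))
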